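{- Let $n = 2^m$ with $m \geq 2$, $N = n/2$, and let $H$ be the subgroup (under $\Delta$) of the power set of $\{1,\dots,N-1\}$ generated by $\{\{j, 2^{i-1}+j\} : j = 1, \dots, 2^{i-1}-1,\ i = 2, \dots, m-1\}$. For $A, B \in H$, $2 \le j \le n/4$, $r \in \{1, \dots, N\}$, $s \in \{2j-1, \dots, N+2j-2\}$, consider the following four edges of $Q_n$: $e^1_r = \big(\overline{\langle N-r+1\rangle}\Delta\theta(\langle r-1\rangle),\ \overline{\langle N-r+2\rangle}\Delta\theta(\langle r-1\rangle)\big)$, $e^1_{N+r} = \big(\langle N-r+1\rangle\Delta\theta(\overline{\langle r-1\rangle}),\ \langle N-r+2\rangle\Delta\theta(\overline{\langle r-1\rangle})\big)$, $e^j_{s,A,B} = \big(A\Delta\langle 2j-2\rangle\Delta\overline{\langle N-s+2j-1\rangle}\Delta\theta(\langle s-1\rangle\Delta\langle 2j-2\rangle\Delta B),\ A\Delta\langle 2j-2\rangle\Delta\overline{\langle N-s+2j\rangle}\Delta\theta(\langle s-1\rangle\Delta\langle 2j-2\rangle\Delta B)\big)$, $e^j_{N+s,A,B} = \big(A\Delta\langle 2j-2\rangle\Delta\langle N-s+2j-1\rangle\Delta\theta(\overline{\langle s-1\rangle}\Delta\langle 2j-2\rangle\Delta B),\ A\Delta\langle 2j-2\rangle\Delta\langle N-s+2j\rangle\Delta\theta(\overline{\langle s-1\rangle}\Delta\langle 2j-2\rangle\Delta B)\big)$. Then these four edges are pairwise vertex-disjoint.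
   Context: Vertices of $Q_n$ are subsets of $\{1,\dots,n\}$, adjacent iff their symmetric difference $\Delta$ has one element. With $N = n/2$: $\langle 0\rangle = \emptyset$; $\langle i\rangle = \{1, \dots, i\}$ for $1 \le i \le N$; $\langle N+i\rangle = \{i+1, \dots, N\}$ for $1 \le i \le N$. For $X \subseteq \{1,\dots,N\}$, $\overline{X} = \{1,\dots,N\}\setminus X$. $\theta(i) = i+N$ and $\theta(X) = \{\theta(x): x\in X\}$, $\theta(\emptyset)=\emptyset$. -}

module Defs where

open import Data.Nat using (ℕ; zero; suc; _+_; _*_; _∸_; _^_; _≤_; _≤ᵇ_; _≡ᵇ_)
open import Data.Bool using (Bool; true; false; _∨_; _xor_; if_then_else_)
open import Data.Fin using (Fin; toℕ)
open import Data.Fin.Subset using (Subset; ∁; ⊥)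
open import Data.Vec using (Vec; tabulate; zipWith; _++_)
open import Data.Product using (_×_; _,_)
open import Relation.Binary.PropositionalEquality using (_≡_; _≢_)

-- A subset of {1,…,N} is a 'Subset N'; position k : Fin N stands for the element (toℕ k + 1).
-- A vertex of Q_n with n = N + N is a 'Subset (N + N)'; position k stands for element toℕ k + 1.

fromPred : (N : ℕ) → (ℕ → Bool) → Subset N
fromPred N p = tabulate (λ k → p (suc (toℕ k)))

infixl 6 _Δ_
_Δ_ : ∀ {n} → Subset n → Subset n → Subset n
_Δ_ = zipWith _xor_

⟨_⟩ : ∀ {N} → ℕ → Subset N
⟨_⟩ {N} i = if i ≤ᵇ N
  then fromPred N (λ x → x ≤ᵇ i)
  else fromPred N (λ x → suc (i ∸ N) ≤ᵇ x)

‾ : ∀ {N} → Subset N → Subset N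
‾ = ∁

-- θ(i) = i + N, applied elementwise: subsets of {1..N} ↦ subsets of {N+1..2N}
θ : ∀ N → Subset N → Subset (N + N)
θ N X = ⊥ ++ X

ι : ∀ N → Subset N → Subset (N + N)
ι N X = X ++ ⊥

pair : ∀ {N} → ℕ → ℕ → Subset N
pair {N} a b = fromPred N (λ x → (x ≡ᵇ a) ∨ (x ≡ᵇ b))

data H (m : ℕ) : Subset (2 ^ (m ∸ 1)) → Set where
  H-∅   : H m ⊥
  H-gen : ∀ i j → 2 ≤ i → i ≤ m ∸ 1 → 1 ≤ j → j ≤ 2 ^ (i ∸ 1) ∸ 1 →
          H m (pair j (2 ^ (i ∸ 1) + j))
  H-Δ   : ∀ {X Y} → H m X → H m Y → H m (X Δ Y)

Edge : ℕ → Set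
Edge n = Subset n × Subset n

VertexDisjoint : ∀ {n} → Edge n → Edge n → Set
VertexDisjoint (a , b) (c , d) = a ≢ c × a ≢ d × b ≢ c × b ≢ d

e1 : (N r : ℕ) → Edge (N + N)
e1 N r = ( ι N (‾ ⟨ N ∸ r + 1 ⟩) Δ θ N ⟨ r ∸ 1 ⟩
         , ι N (‾ ⟨ N ∸ r + 2 ⟩) Δ θ N ⟨ r ∸ 1 ⟩ )

e1N : (N r : ℕ) → Edge (N + N)
e1N N r = ( ι N ⟨ N ∸ r + 1 ⟩ Δ θ N (‾ ⟨ r ∸ 1 ⟩)
          , ι N ⟨ N ∸ r + 2 ⟩ Δ θ N (‾ ⟨ r ∸ 1 ⟩) )

ej : (N j s : ℕ) → (A B : Subset N) → Edge (N + N)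
ej N j s A B =
  ( ι N A Δ ι N ⟨ 2 * j ∸ 2 ⟩ Δ ι N (‾ ⟨ N + 2 * j ∸ 1 ∸ s ⟩) Δ θ N (⟨ s ∸ 1 ⟩ Δ ⟨ 2 * j ∸ 2 ⟩ Δ B)
  , ι N A Δ ι N ⟨ 2 * j ∸ 2 ⟩ Δ ι N (‾ ⟨ N + 2 * j ∸ s ⟩) Δ θ N (⟨ s ∸ 1 ⟩ Δ ⟨ 2 * j ∸ 2 ⟩ Δ B) )

ejN : (N j s : ℕ) → (A B : Subset N) → Edge (N + N)
ejN N j s A B =
  ( ι N A Δ ι N ⟨ 2 * j ∸ 2 ⟩ Δ ι N ⟨ N + 2 * j ∸ 1 ∸ s ⟩ Δ θ N (‾ ⟨ s ∸ 1 ⟩ Δ ⟨ 2 * j ∸ 2 ⟩ Δ B)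
  , ι N A Δ ι N ⟨ 2 * j ∸ 2 ⟩ Δ ι N ⟨ N + 2 * j ∸ s ⟩ Δ θ N (‾ ⟨ s ∸ 1 ⟩ Δ ⟨ 2 * j ∸ 2 ⟩ Δ B) )

-- For a digit position q, readBit q X is the parity of the number of y ∈ X at which the q-th binary digit of y
-- differs from that of y − 1. It is Δ-linear, telescopes to readBit q ⟨ i ⟩ = bit q i, ignores complements in
-- {1,…,N} when 2^(q+1) ∣ N, and vanishes on H, since the two elements of a generator {j, 2^e + j} carry equal
-- weights. Applied to both halves of a vertex, these functionals read off the digits of a and x from a vertex of
-- e¹ (where a + x ∈ {N, N + 1}), and those of b ⊕ c and t ⊕ c from a vertex of eʲ (where b + t ∈ {N + c, N + c + 1}),
-- with c = 2j − 2 = 2^(P+1) (2u + 1). A common vertex would force a ≡ b + c and x ≡ t + c modulo 2^(P+2), as adding c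
-- produces no carry below position P + 1; then N + {0,1} ≡ N + 3c + {0,1} ≡ N + 2^(P+1) + {0,1}, which is absurd.
-- The remaining two pairs of edges are separated by their upper halves, which are complementary.
module Submission where

open import Defs
open import Data.Nat using (ℕ; zero; suc; _+_; _*_; _∸_; _^_; _≤_; _<_; z≤n; s≤s; _≤ᵇ_; _≡ᵇ_; _≟_; pred; ⌊_/2⌋)
open import Data.Nat.Properties
open import Data.Nat.Divisibility using (_∣_; divides; ∣m⇒∣m*n; ∣-trans; ∣-refl)
open import Data.Nat.Induction using (<-rec)
open import Data.Nat.Solver using (module +-*-Solver)
open import Data.Bool using (Bool; true; false; _∨_; _∧_; _xor_; not)
open import Data.Bool.Properties
  using (xor-same; xor-comm; xor-assoc; xor-identityʳ; true-xor; not-distribˡ-xor; T-≡; ¬-not; not-¬)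
open import Data.Bool.Solver using (module xor-∧-Solver)
open import Data.Fin using (Fin; toℕ) renaming (zero to fzero; suc to fsuc)
open import Data.Fin.Subset using (Subset; ∁; ⊥)
open import Data.Vec using ([]; _∷_; _++_; tabulate; zipWith)
open import Data.Vec.Properties
  using (zipWith-++; zipWith-identityˡ; zipWith-identityʳ; ∷-injectiveˡ; ++-injectiveˡ; ++-injectiveʳ)
open import Data.Product using (∃; ∃₂; _×_; _,_; proj₁; proj₂)
open import Data.Empty using (⊥-elim) renaming (⊥ to Empty)
open import Function using (_∘_)
open import Function.Bundles using (Equivalence)
open import Relation.Nullary using (yes; no)
open import Relation.Binary.PropositionalEquality
open ≡-Reasoning

open +-*-Solver using (solve; _:+_; _:*_; _:=_; con)
open xor-∧-Solver using () renaming (solve to solveᵇ; _:+_ to _:⊕_; _:*_ to _:∧_; _:=_ to _:≡_; con to conᵇ)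

xor-cancel-middle : ∀ a b c → (a xor b) xor (c xor a) ≡ c xor b
xor-cancel-middle a b c = begin
  (a xor b) xor (c xor a) ≡⟨ solveᵇ 3 (λ a b c → (a :⊕ b) :⊕ (c :⊕ a) :≡ (c :⊕ b) :⊕ (a :⊕ a)) refl a b c ⟩
  (c xor b) xor (a xor a) ≡⟨ cong ((c xor b) xor_) (xor-same a) ⟩
  (c xor b) xor false     ≡⟨ xor-identityʳ _ ⟩
  c xor b                 ∎

xor-cancel-common : ∀ a b x → (a xor x) xor (b xor x) ≡ a xor b
xor-cancel-common a b x = begin
  (a xor x) xor (b xor x) ≡⟨ solveᵇ 3 (λ a b x → (a :⊕ x) :⊕ (b :⊕ x) :≡ (a :⊕ b) :⊕ (x :⊕ x)) refl a b x ⟩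
  (a xor b) xor (x xor x) ≡⟨ cong ((a xor b) xor_) (xor-same x) ⟩
  (a xor b) xor false     ≡⟨ xor-identityʳ _ ⟩
  a xor b                 ∎

∨-∧-as-xor : ∀ a b d → (a ≡ true → b ≡ false) → (a ∨ b) ∧ d ≡ (a ∧ d) xor (b ∧ d)
∨-∧-as-xor true  b d b≡false rewrite b≡false refl = sym (xor-identityʳ d)
∨-∧-as-xor false b d _                            = refl

≤ᵇ-true : ∀ {m n} → m ≤ n → (m ≤ᵇ n) ≡ true
≤ᵇ-true = Equivalence.to T-≡ ∘ ≤⇒≤ᵇ

≤ᵇ-false : ∀ {m n} → n < m → (m ≤ᵇ n) ≡ false
≤ᵇ-false {m} {n} n<m = ¬-not (λ m≤ᵇn → <⇒≱ n<m (≤ᵇ⇒≤ m n (Equivalence.from T-≡ m≤ᵇn)))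

≡ᵇ-true : ∀ {m n} → m ≡ n → (m ≡ᵇ n) ≡ true
≡ᵇ-true {m} {n} = Equivalence.to T-≡ ∘ ≡⇒≡ᵇ m n

≡ᵇ-false : ∀ {m n} → m ≢ n → (m ≡ᵇ n) ≡ false
≡ᵇ-false {m} {n} m≢n = ¬-not (λ m≡ᵇn → m≢n (≡ᵇ⇒≡ m n (Equivalence.from T-≡ m≡ᵇn)))

odd : ℕ → Bool
odd zero          = false
odd (suc zero)    = true
odd (suc (suc n)) = odd n

digit : Bool → ℕ
digit false = 0
digit true  = 1

bit : ℕ → ℕ → Bool
bit zero    n = odd n
bit (suc q) n = bit q ⌊ n /2⌋

+-2*-suc : ∀ m n → m + 2 * suc n ≡ suc (suc (m + 2 * n))
+-2*-suc m n = trans (cong (m +_) (*-suc 2 n)) (trans (+-suc m _) (cong suc (+-suc m _)))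

odd-suc : ∀ n → odd (suc n) ≡ not (odd n)
odd-suc zero          = refl
odd-suc (suc zero)    = refl
odd-suc (suc (suc n)) = odd-suc n

odd-+ : ∀ m n → odd (m + n) ≡ odd m xor odd n
odd-+ zero          n = refl
odd-+ (suc zero)    n = odd-suc n
odd-+ (suc (suc m)) n = odd-+ m n

odd-+-2* : ∀ m n → odd (m + 2 * n) ≡ odd m
odd-+-2* m zero    = cong odd (+-identityʳ m)
odd-+-2* m (suc n) rewrite +-2*-suc m n = odd-+-2* m n

⌊m+2n/2⌋≡⌊m/2⌋+n : ∀ m n → ⌊ m + 2 * n /2⌋ ≡ ⌊ m /2⌋ + n
⌊m+2n/2⌋≡⌊m/2⌋+n m zero    = trans (cong ⌊_/2⌋ (+-identityʳ m)) (sym (+-identityʳ _))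
⌊m+2n/2⌋≡⌊m/2⌋+n m (suc n) rewrite +-2*-suc m n = trans (cong suc (⌊m+2n/2⌋≡⌊m/2⌋+n m n)) (sym (+-suc _ n))

n≡odd+2*⌊n/2⌋ : ∀ n → n ≡ digit (odd n) + 2 * ⌊ n /2⌋
n≡odd+2*⌊n/2⌋ zero          = refl
n≡odd+2*⌊n/2⌋ (suc zero)    = refl
n≡odd+2*⌊n/2⌋ (suc (suc n)) =
  trans (cong (suc ∘ suc) (n≡odd+2*⌊n/2⌋ n)) (sym (+-2*-suc (digit (odd n)) ⌊ n /2⌋))

m<2n⇒⌊m/2⌋<n : ∀ m n → m < 2 * n → ⌊ m /2⌋ < n
m<2n⇒⌊m/2⌋<n m             zero    ()
m<2n⇒⌊m/2⌋<n zero          (suc n) _ = s≤s z≤n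
m<2n⇒⌊m/2⌋<n (suc zero)    (suc n) _ = s≤s z≤n
m<2n⇒⌊m/2⌋<n (suc (suc m)) (suc n) m< rewrite *-suc 2 n = s≤s (m<2n⇒⌊m/2⌋<n m n (≤-pred (≤-pred m<)))

bit-0 : ∀ q → bit q 0 ≡ false
bit-0 zero    = refl
bit-0 (suc q) = bit-0 q

bit-+-2^suc* : ∀ q m n → bit q (m + 2 ^ suc q * n) ≡ bit q m
bit-+-2^suc* zero    m n = odd-+-2* m n
bit-+-2^suc* (suc q) m n rewrite *-assoc 2 (2 ^ suc q) n | ⌊m+2n/2⌋≡⌊m/2⌋+n m (2 ^ suc q * n) =
  bit-+-2^suc* q ⌊ m /2⌋ n

2^∣2^ : ∀ {m n} → m ≤ n → 2 ^ m ∣ 2 ^ n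
2^∣2^ {m} {n} m≤n = divides (2 ^ (n ∸ m)) (begin
  2 ^ n               ≡⟨ cong (2 ^_) (sym (m+[n∸m]≡n m≤n)) ⟩
  2 ^ (m + (n ∸ m))   ≡⟨ ^-distribˡ-+-* 2 m (n ∸ m) ⟩
  2 ^ m * 2 ^ (n ∸ m) ≡⟨ *-comm (2 ^ m) _ ⟩
  2 ^ (n ∸ m) * 2 ^ m ∎)

2^-cancel-< : ∀ {m n} → 2 ^ m < 2 ^ n → m < n
2^-cancel-< 2^m<2^n = ≰⇒> (λ n≤m → <⇒≱ 2^m<2^n (^-monoʳ-≤ 2 n≤m))

bit-+-∣ : ∀ q m {n} → 2 ^ suc q ∣ n → bit q (m + n) ≡ bit q m
bit-+-∣ q m (divides z refl) = trans (cong (λ p → bit q (m + p)) (*-comm z _)) (bit-+-2^suc* q m z)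

bit-∣ : ∀ q {n} → 2 ^ suc q ∣ n → bit q n ≡ false
bit-∣ q 2^q+1∣n = trans (bit-+-∣ q 0 2^q+1∣n) (bit-0 q)

bit-+-2^ : ∀ k m q → m < 2 ^ k → bit q (m + 2 ^ k) ≡ bit q m xor (q ≡ᵇ k)
bit-+-2^ zero    zero    zero    _ = refl
bit-+-2^ zero    zero    (suc q) _ = trans (bit-0 q) (sym (cong (_xor false) (bit-0 q)))
bit-+-2^ zero    (suc m) q       (s≤s ())
bit-+-2^ (suc k) m       zero    _ = trans (odd-+-2* m (2 ^ k)) (sym (xor-identityʳ _))
bit-+-2^ (suc k) m       (suc q) m< rewrite ⌊m+2n/2⌋≡⌊m/2⌋+n m (2 ^ k) =
  bit-+-2^ k ⌊ m /2⌋ q (m<2n⇒⌊m/2⌋<n m (2 ^ k) m<)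

odd-part : ∀ n → 0 < n → ∃₂ λ P u → n ≡ 2 ^ P * suc (2 * u)
odd-part = <-rec _ step
  where
  step : ∀ n → (∀ {m} → m < n → 0 < m → ∃₂ λ P u → m ≡ 2 ^ P * suc (2 * u)) →
         0 < n → ∃₂ λ P u → n ≡ 2 ^ P * suc (2 * u)
  step n rec 0<n with odd n | n≡odd+2*⌊n/2⌋ n
  ... | true  | n≡1+2h = 0 , ⌊ n /2⌋ , trans n≡1+2h (sym (+-identityʳ _))
  ... | false | n≡2h  = double (rec (subst (h <_) (sym n≡2h) (m<m+n h h+0>0)) h>0)
    where
    h = ⌊ n /2⌋
    h>0 : 0 < h
    h>0 = n≢0⇒n>0 (λ h≡0 → <⇒≢ 0<n (sym (trans n≡2h (cong (2 *_) h≡0))))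
    h+0>0 : 0 < h + 0
    h+0>0 = subst (0 <_) (sym (+-identityʳ h)) h>0
    double : (∃₂ λ P u → h ≡ 2 ^ P * suc (2 * u)) → ∃₂ λ P u → n ≡ 2 ^ P * suc (2 * u)
    double (P , u , h≡) = suc P , u , trans n≡2h (trans (cong (2 *_) h≡) (sym (*-assoc 2 (2 ^ P) _)))

lowBits : ℕ → ℕ → ℕ
lowBits zero    n = 0
lowBits (suc k) n = digit (odd n) + 2 * lowBits k ⌊ n /2⌋

lowBits-+-2^* : ∀ k m n → lowBits k (m + 2 ^ k * n) ≡ lowBits k m
lowBits-+-2^* zero    m n = refl
lowBits-+-2^* (suc k) m n
  rewrite *-assoc 2 (2 ^ k) n | odd-+-2* m (2 ^ k * n) | ⌊m+2n/2⌋≡⌊m/2⌋+n m (2 ^ k * n) | lowBits-+-2^* k ⌊ m /2⌋ n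
  = refl

lowBits-< : ∀ k n → n < 2 ^ k → lowBits k n ≡ n
lowBits-< zero    zero    _ = refl
lowBits-< zero    (suc n) (s≤s ())
lowBits-< (suc k) n       n< rewrite lowBits-< k ⌊ n /2⌋ (m<2n⇒⌊m/2⌋<n n (2 ^ k) n<) = sym (n≡odd+2*⌊n/2⌋ n)

n≡lowBits+2^* : ∀ k n → ∃ λ h → n ≡ lowBits k n + 2 ^ k * h
n≡lowBits+2^* zero    n = n , sym (+-identityʳ n)
n≡lowBits+2^* (suc k) n with n≡lowBits+2^* k ⌊ n /2⌋
... | h , e = h , (begin
  n                                                    ≡⟨ n≡odd+2*⌊n/2⌋ n ⟩
  digit (odd n) + 2 * ⌊ n /2⌋                          ≡⟨ cong (λ m → digit (odd n) + 2 * m) e ⟩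
  digit (odd n) + 2 * (lowBits k ⌊ n /2⌋ + 2 ^ k * h)  ≡⟨ solve 4 (λ d l p h → d :+ con 2 :* (l :+ p :* h)
                                                                      := (d :+ con 2 :* l) :+ (con 2 :* p) :* h)
                                                            refl (digit (odd n)) (lowBits k ⌊ n /2⌋) (2 ^ k) h ⟩
  lowBits (suc k) n + 2 ^ suc k * h                    ∎)

lowBits-+ : ∀ k m n → lowBits k (m + n) ≡ lowBits k (lowBits k m + lowBits k n)
lowBits-+ k m n with n≡lowBits+2^* k m | n≡lowBits+2^* k n
... | hm , em | hn , en = begin
  lowBits k (m + n)                                   ≡⟨ cong (lowBits k) (cong₂ _+_ em en) ⟩
  lowBits k ((lm + 2 ^ k * hm) + (ln + 2 ^ k * hn))   ≡⟨ cong (lowBits k) (solve 5 (λ lm ln p hm hn →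
                                                             (lm :+ p :* hm) :+ (ln :+ p :* hn) := (lm :+ ln) :+ p :* (hm :+ hn))
                                                           refl lm ln (2 ^ k) hm hn) ⟩
  lowBits k ((lm + ln) + 2 ^ k * (hm + hn))           ≡⟨ lowBits-+-2^* k (lm + ln) (hm + hn) ⟩
  lowBits k (lm + ln)                                 ∎
  where
  lm = lowBits k m
  ln = lowBits k n

bits-xor⇒lowBits-+ : ∀ P a b c → (∀ q → q ≤ P → bit q a ≡ bit q b xor bit q c) → (∀ q → q < P → bit q c ≡ false) →
                     lowBits (suc P) a ≡ lowBits (suc P) (b + c)
bits-xor⇒lowBits-+ zero    a b c a≡b⊕c _ = cong (λ d → digit d + 0) (trans (a≡b⊕c 0 z≤n) (sym (odd-+ b c)))
bits-xor⇒lowBits-+ (suc P) a b c a≡b⊕c c₀ =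
  cong₂ (λ d l → digit d + 2 * l) (trans (a≡b⊕c 0 z≤n) (sym (odd-+ b c)))
                                  (trans halves (cong (lowBits (suc P)) (sym ⌊b+c/2⌋)))
  where
  ⌊b+c/2⌋ : ⌊ b + c /2⌋ ≡ ⌊ b /2⌋ + ⌊ c /2⌋
  ⌊b+c/2⌋ = trans (cong (λ n → ⌊ b + n /2⌋) (trans (n≡odd+2*⌊n/2⌋ c) (cong (λ d → digit d + 2 * ⌊ c /2⌋) (c₀ 0 (s≤s z≤n)))))
                  (⌊m+2n/2⌋≡⌊m/2⌋+n b ⌊ c /2⌋)
  halves : lowBits (suc P) ⌊ a /2⌋ ≡ lowBits (suc P) (⌊ b /2⌋ + ⌊ c /2⌋)
  halves = bits-xor⇒lowBits-+ P ⌊ a /2⌋ ⌊ b /2⌋ ⌊ c /2⌋ (λ q q≤P → a≡b⊕c (suc q) (s≤s q≤P)) (λ q q<P → c₀ (suc q) (s≤s q<P))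

carry-clash : ∀ P u N a x b t c α β → c ≡ 2 ^ suc P * suc (2 * u) → 2 ^ suc (suc P) ∣ N →
              (∀ q → q ≤ suc P → bit q a ≡ bit q b xor bit q c) → (∀ q → q ≤ suc P → bit q x ≡ bit q t xor bit q c) →
              a + x ≡ N + α → b + t ≡ N + c + β → α ≤ 1 → β ≤ 1 → Empty
carry-clash P u N a x b t c α β c≡ (divides z N≡) a-bits x-bits a+x≡ b+t≡ α≤1 β≤1 =
  <⇒≱ (≤-trans (s≤s α≤1) 2≤h) (≤-trans (m≤n+m h β) (≤-reflexive (sym α≡β+h)))
  where
  h = 2 ^ suc P
  W = suc (suc P)
  2≤h : 2 ≤ h
  2≤h = *-monoʳ-≤ 2 (m^n>0 2 P)
  c₀ : ∀ q → q < suc P → bit q c ≡ false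
  c₀ q q<P = trans (cong (bit q) c≡) (bit-∣ q (∣m⇒∣m*n (suc (2 * u)) (2^∣2^ q<P)))
  b+c+t+c≡ : (b + c) + (t + c) ≡ (β + h) + 2 ^ W * (z + suc (3 * u))
  b+c+t+c≡ = begin
    (b + c) + (t + c)                                 ≡⟨ solve 3 (λ b t c → (b :+ c) :+ (t :+ c) := (b :+ t) :+ con 2 :* c)
                                                               refl b t c ⟩
    (b + t) + 2 * c                                   ≡⟨ cong (λ n → n + 2 * c) b+t≡ ⟩
    N + c + β + 2 * c                                 ≡⟨ cong₂ (λ n d → n + d + β + 2 * d) N≡ c≡ ⟩
    z * (2 * h) + h * suc (2 * u) + β + 2 * (h * suc (2 * u))
                                                      ≡⟨ solve 4 (λ h z u β →
                                                                   z :* (con 2 :* h) :+ h :* (con 1 :+ con 2 :* u) :+ β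
                                                                     :+ con 2 :* (h :* (con 1 :+ con 2 :* u))
                                                                   := (β :+ h) :+ (con 2 :* h) :* (z :+ (con 1 :+ con 3 :* u)))
                                                               refl h z u β ⟩
    (β + h) + 2 ^ W * (z + suc (3 * u))               ∎
  α≡β+h : α ≡ β + h
  α≡β+h = begin
    α                                                 ≡⟨ sym (lowBits-< W α α<2^W) ⟩
    lowBits W α                                       ≡⟨ sym (lowBits-+-2^* W α z) ⟩
    lowBits W (α + 2 ^ W * z)                         ≡⟨ cong (lowBits W) (trans (+-comm α _) (sym a+x≡α+2^Wz)) ⟩
    lowBits W (a + x)                                 ≡⟨ lowBits-+ W a x ⟩
    lowBits W (lowBits W a + lowBits W x)             ≡⟨ cong₂ (λ p q → lowBits W (p + q))
                                                               (bits-xor⇒lowBits-+ (suc P) a b c a-bits c₀)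
                                                               (bits-xor⇒lowBits-+ (suc P) x t c x-bits c₀) ⟩
    lowBits W (lowBits W (b + c) + lowBits W (t + c)) ≡⟨ sym (lowBits-+ W (b + c) (t + c)) ⟩
    lowBits W ((b + c) + (t + c))                     ≡⟨ cong (lowBits W) b+c+t+c≡ ⟩
    lowBits W ((β + h) + 2 ^ W * (z + suc (3 * u)))   ≡⟨ lowBits-+-2^* W (β + h) _ ⟩
    lowBits W (β + h)                                 ≡⟨ lowBits-< W (β + h) β+h<2^W ⟩
    β + h                                             ∎
    where
    α<2^W : α < 2 ^ W
    α<2^W = ≤-trans (s≤s α≤1) (≤-trans 2≤h (m≤m+n h _))
    a+x≡α+2^Wz : a + x ≡ 2 ^ W * z + α
    a+x≡α+2^Wz = trans a+x≡ (cong (_+ α) (trans N≡ (*-comm z _)))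
    β+h<2^W : β + h < 2 ^ W
    β+h<2^W = ≤-trans (s≤s (+-monoˡ-≤ h β≤1)) (≤-trans (+-monoˡ-≤ h 2≤h) (≤-reflexive (cong (h +_) (sym (+-identityʳ h)))))

xorRange : (ℕ → Bool) → ℕ → ℕ → Bool
xorRange f o zero    = false
xorRange f o (suc n) = f (suc o) xor xorRange f (suc o) n

xorRange-xor : ∀ (f g : ℕ → Bool) o n → xorRange (λ y → f y xor g y) o n ≡ xorRange f o n xor xorRange g o n
xorRange-xor f g o zero    = refl
xorRange-xor f g o (suc n) rewrite xorRange-xor f g (suc o) n =
  solveᵇ 4 (λ a b F G → (a :⊕ b) :⊕ (F :⊕ G) :≡ (a :⊕ F) :⊕ (b :⊕ G)) refl (f (suc o)) (g (suc o)) _ _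

xorRange-cong : ∀ (f g : ℕ → Bool) o n → (∀ y → o < y → y ≤ o + n → f y ≡ g y) → xorRange f o n ≡ xorRange g o n
xorRange-cong f g o zero    _   = refl
xorRange-cong f g o (suc n) f≗g rewrite +-suc o n =
  cong₂ _xor_ (f≗g (suc o) ≤-refl (s≤s (m≤m+n o n)))
              (xorRange-cong f g (suc o) n (λ y o<y y≤ → f≗g y (<⇒≤ o<y) y≤))

xorRange-false : ∀ (f : ℕ → Bool) o n → (∀ y → o < y → y ≤ o + n → f y ≡ false) → xorRange f o n ≡ false
xorRange-false f o zero    _  = refl
xorRange-false f o (suc n) f≡ rewrite +-suc o n | f≡ (suc o) ≤-refl (s≤s (m≤m+n o n)) =
  xorRange-false f (suc o) n (λ y o<y y≤ → f≡ y (<⇒≤ o<y) y≤)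

xorRange-+ : ∀ (f : ℕ → Bool) o m n → xorRange f o (m + n) ≡ xorRange f o m xor xorRange f (o + m) n
xorRange-+ f o zero    n rewrite +-identityʳ o = refl
xorRange-+ f o (suc m) n rewrite xorRange-+ f (suc o) m n | +-suc o m = sym (xor-assoc (f (suc o)) _ _)

xorRange-telescope : ∀ (g : ℕ → Bool) o n → xorRange (λ y → g y xor g (pred y)) o n ≡ g (o + n) xor g o
xorRange-telescope g o zero    rewrite +-identityʳ o = sym (xor-same (g o))
xorRange-telescope g o (suc n) rewrite xorRange-telescope g (suc o) n | +-suc o n =
  xor-cancel-middle (g (suc o)) (g o) (g (suc (o + n)))

xorRange-point : ∀ (f : ℕ → Bool) a o n → o < a → a ≤ o + n → xorRange (λ y → (y ≡ᵇ a) ∧ f y) o n ≡ f a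
xorRange-point f a o zero    o<a a≤o+0 = ⊥-elim (<⇒≱ o<a (≤-trans a≤o+0 (≤-reflexive (+-identityʳ o))))
xorRange-point f a o (suc n) o<a a≤ with suc o ≟ a
... | yes refl rewrite ≡ᵇ-true {suc o} refl =
  trans (cong (f (suc o) xor_) (xorRange-false _ (suc o) n (λ y o<y _ → cong (_∧ f y) (≡ᵇ-false (>⇒≢ o<y)))))
        (xor-identityʳ _)
... | no o+1≢a rewrite ≡ᵇ-false o+1≢a =
  xorRange-point f a (suc o) n (≤∧≢⇒< o<a o+1≢a) (≤-trans a≤ (≤-reflexive (+-suc o n)))

xorRange-≤ᵇ : ∀ (f : ℕ → Bool) i n → i ≤ n → xorRange (λ y → (y ≤ᵇ i) ∧ f y) 0 n ≡ xorRange f 0 i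
xorRange-≤ᵇ f i n i≤n = begin
  xorRange g 0 n                                ≡⟨ cong (xorRange g 0) (sym (m+[n∸m]≡n i≤n)) ⟩
  xorRange g 0 (i + (n ∸ i))                    ≡⟨ xorRange-+ g 0 i (n ∸ i) ⟩
  xorRange g 0 i xor xorRange g i (n ∸ i)       ≡⟨ cong₂ _xor_
                                                     (xorRange-cong g f 0 i (λ y _ y≤i → cong (_∧ f y) (≤ᵇ-true y≤i)))
                                                     (xorRange-false g i (n ∸ i) (λ y i<y _ → cong (_∧ f y) (≤ᵇ-false i<y))) ⟩
  xorRange f 0 i xor false                      ≡⟨ xor-identityʳ _ ⟩
  xorRange f 0 i                                ∎
  where
  g : ℕ → Bool
  g y = (y ≤ᵇ i) ∧ f y

xorRange->ᵇ : ∀ (f : ℕ → Bool) e n → e ≤ n → xorRange (λ y → (suc e ≤ᵇ y) ∧ f y) 0 n ≡ xorRange f e (n ∸ e)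
xorRange->ᵇ f e n e≤n = begin
  xorRange g 0 n                                ≡⟨ cong (xorRange g 0) (sym (m+[n∸m]≡n e≤n)) ⟩
  xorRange g 0 (e + (n ∸ e))                    ≡⟨ xorRange-+ g 0 e (n ∸ e) ⟩
  xorRange g 0 e xor xorRange g e (n ∸ e)       ≡⟨ cong₂ _xor_
                                                     (xorRange-false g 0 e (λ y _ y≤e → cong (_∧ f y) (≤ᵇ-false (s≤s y≤e))))
                                                     (xorRange-cong g f e (n ∸ e) (λ y e<y _ → cong (_∧ f y) (≤ᵇ-true e<y))) ⟩
  false xor xorRange f e (n ∸ e)                ∎
  where
  g : ℕ → Bool
  g y = (suc e ≤ᵇ y) ∧ f y

-- Position k of the vector stands for the element o + k + 1.
xorWeight : (ℕ → Bool) → ℕ → ∀ {n} → Subset n → Bool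
xorWeight w o []      = false
xorWeight w o (x ∷ X) = (x ∧ w (suc o)) xor xorWeight w (suc o) X

xorWeight-Δ : ∀ w o {n} (X Y : Subset n) → xorWeight w o (X Δ Y) ≡ xorWeight w o X xor xorWeight w o Y
xorWeight-Δ w o []      []      = refl
xorWeight-Δ w o (x ∷ X) (y ∷ Y) rewrite xorWeight-Δ w (suc o) X Y =
  solveᵇ 5 (λ x y d S T → ((x :⊕ y) :∧ d) :⊕ (S :⊕ T) :≡ ((x :∧ d) :⊕ S) :⊕ ((y :∧ d) :⊕ T)) refl x y (w (suc o)) _ _

xorWeight-∁ : ∀ w o {n} (X : Subset n) → xorWeight w o (∁ X) ≡ xorWeight w o X xor xorRange w o n
xorWeight-∁ w o []      = refl
xorWeight-∁ w o (x ∷ X) rewrite xorWeight-∁ w (suc o) X | sym (true-xor x) =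
  solveᵇ 4 (λ x d S R → ((conᵇ true :⊕ x) :∧ d) :⊕ (S :⊕ R) :≡ ((x :∧ d) :⊕ S) :⊕ (d :⊕ R)) refl x (w (suc o)) _ _

xorWeight-⊥ : ∀ w o n → xorWeight w o (⊥ {n}) ≡ false
xorWeight-⊥ w o zero    = refl
xorWeight-⊥ w o (suc n) = xorWeight-⊥ w (suc o) n

xorWeight-tabulate : ∀ w o {n} (f : Fin n → Bool) (p : ℕ → Bool) → (∀ k → f k ≡ p (suc (o + toℕ k))) →
                     xorWeight w o (tabulate f) ≡ xorRange (λ y → p y ∧ w y) o n
xorWeight-tabulate w o {zero}  f p f≗p = refl
xorWeight-tabulate w o {suc n} f p f≗p =
  cong₂ _xor_ (cong (_∧ w (suc o)) (trans (f≗p fzero) (cong (p ∘ suc) (+-identityʳ o))))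
              (xorWeight-tabulate w (suc o) (f ∘ fsuc) p (λ k → trans (f≗p (fsuc k)) (cong (p ∘ suc) (+-suc o (toℕ k)))))

xorWeight-fromPred : ∀ w N p → xorWeight w 0 (fromPred N p) ≡ xorRange (λ y → p y ∧ w y) 0 N
xorWeight-fromPred w N p = xorWeight-tabulate w 0 {N} _ p (λ _ → refl)

bitJump : ℕ → ℕ → Bool
bitJump q y = bit q y xor bit q (pred y)

readBit : ℕ → ∀ {n} → Subset n → Bool
readBit q = xorWeight (bitJump q) 0

readBit-Δ : ∀ q {n} (X Y : Subset n) → readBit q (X Δ Y) ≡ readBit q X xor readBit q Y
readBit-Δ q = xorWeight-Δ (bitJump q) 0

readBit-Δ₃ : ∀ q {n} (X Y Z : Subset n) → readBit q (X Δ Y Δ Z) ≡ (readBit q X xor readBit q Y) xor readBit q Z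
readBit-Δ₃ q X Y Z = trans (readBit-Δ q (X Δ Y) Z) (cong (_xor readBit q Z) (readBit-Δ q X Y))

readBit-∁ : ∀ q {n} (X : Subset n) → 2 ^ suc q ∣ n → readBit q (∁ X) ≡ readBit q X
readBit-∁ q {n} X 2^q+1∣n = begin
  readBit q (∁ X)                                ≡⟨ xorWeight-∁ (bitJump q) 0 X ⟩
  readBit q X xor xorRange (bitJump q) 0 n       ≡⟨ cong (readBit q X xor_) (xorRange-telescope (bit q) 0 n) ⟩
  readBit q X xor (bit q n xor bit q 0)          ≡⟨ cong₂ (λ a b → readBit q X xor (a xor b)) (bit-∣ q 2^q+1∣n) (bit-0 q) ⟩
  readBit q X xor false                          ≡⟨ xor-identityʳ _ ⟩
  readBit q X                                    ∎

readBit-⟨⟩ : ∀ q {N} i → 2 ^ suc q ∣ N → i ≤ N + N → readBit q (⟨_⟩ {N} i) ≡ bit q i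
readBit-⟨⟩ q {N} i 2^q+1∣N i≤N+N with i ≤? N
... | yes i≤N rewrite ≤ᵇ-true i≤N = begin
  readBit q (fromPred N (λ y → y ≤ᵇ i))               ≡⟨ xorWeight-fromPred (bitJump q) N _ ⟩
  xorRange (λ y → (y ≤ᵇ i) ∧ bitJump q y) 0 N         ≡⟨ xorRange-≤ᵇ (bitJump q) i N i≤N ⟩
  xorRange (bitJump q) 0 i                            ≡⟨ xorRange-telescope (bit q) 0 i ⟩
  bit q i xor bit q 0                                 ≡⟨ cong (bit q i xor_) (bit-0 q) ⟩
  bit q i xor false                                   ≡⟨ xor-identityʳ _ ⟩
  bit q i                                             ∎
... | no i≰N rewrite ≤ᵇ-false (≰⇒> i≰N) = begin
  readBit q (fromPred N (λ y → suc (i ∸ N) ≤ᵇ y))         ≡⟨ xorWeight-fromPred (bitJump q) N _ ⟩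
  xorRange (λ y → (suc (i ∸ N) ≤ᵇ y) ∧ bitJump q y) 0 N   ≡⟨ xorRange->ᵇ (bitJump q) (i ∸ N) N i∸N≤N ⟩
  xorRange (bitJump q) (i ∸ N) (N ∸ (i ∸ N))              ≡⟨ xorRange-telescope (bit q) (i ∸ N) (N ∸ (i ∸ N)) ⟩
  bit q (i ∸ N + (N ∸ (i ∸ N))) xor bit q (i ∸ N)         ≡⟨ cong₂ _xor_ (trans (cong (bit q) (m+[n∸m]≡n i∸N≤N)) (bit-∣ q 2^q+1∣N))
                                                                          (sym (bit-+-∣ q (i ∸ N) 2^q+1∣N)) ⟩
  false xor bit q (i ∸ N + N)                             ≡⟨ cong (bit q) (m∸n+n≡m (<⇒≤ (≰⇒> i≰N))) ⟩
  bit q i                                                 ∎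
  where
  i∸N≤N : i ∸ N ≤ N
  i∸N≤N = ≤-trans (∸-monoˡ-≤ N i≤N+N) (≤-reflexive (m+n∸n≡m N N))

bitJump-2^+ : ∀ q e j → 1 ≤ j → j < 2 ^ e → bitJump q (2 ^ e + j) ≡ bitJump q j
bitJump-2^+ q e (suc j) _ j<2^e rewrite +-suc (2 ^ e) j | +-comm (2 ^ e) j =
  trans (cong₂ _xor_ (bit-+-2^ e (suc j) q j<2^e) (bit-+-2^ e j q (<⇒≤ j<2^e)))
        (xor-cancel-common (bit q (suc j)) (bit q j) (q ≡ᵇ e))

readBit-pair : ∀ q {N} e j → 1 ≤ j → j < 2 ^ e → 2 ^ e + j ≤ N → readBit q (pair {N} j (2 ^ e + j)) ≡ false
readBit-pair q {N} e j 1≤j j<2^e b≤N = begin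
  readBit q (pair {N} j b)                                    ≡⟨ xorWeight-fromPred (bitJump q) N _ ⟩
  xorRange (λ y → ((y ≡ᵇ j) ∨ (y ≡ᵇ b)) ∧ bitJump q y) 0 N   ≡⟨ xorRange-cong _ _ 0 N (λ y _ _ →
                                                                   ∨-∧-as-xor (y ≡ᵇ j) (y ≡ᵇ b) _ (j-not-b y)) ⟩
  xorRange (λ y → ((y ≡ᵇ j) ∧ bitJump q y) xor ((y ≡ᵇ b) ∧ bitJump q y)) 0 N
                                                              ≡⟨ xorRange-xor _ _ 0 N ⟩
  xorRange (λ y → (y ≡ᵇ j) ∧ bitJump q y) 0 N xor xorRange (λ y → (y ≡ᵇ b) ∧ bitJump q y) 0 N
                                                              ≡⟨ cong₂ _xor_ (xorRange-point (bitJump q) j 0 N 1≤j (≤-trans (<⇒≤ j<b) b≤N))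
                                                                             (xorRange-point (bitJump q) b 0 N (≤-trans 1≤j (<⇒≤ j<b)) b≤N) ⟩
  bitJump q j xor bitJump q b                                 ≡⟨ cong (bitJump q j xor_) (bitJump-2^+ q e j 1≤j j<2^e) ⟩
  bitJump q j xor bitJump q j                                 ≡⟨ xor-same (bitJump q j) ⟩
  false                                                       ∎
  where
  b = 2 ^ e + j
  j<b : j < b
  j<b = +-monoˡ-≤ j (m^n>0 2 e)
  j-not-b : ∀ y → (y ≡ᵇ j) ≡ true → (y ≡ᵇ b) ≡ false
  j-not-b y y≡ᵇj = ≡ᵇ-false (λ y≡b → <⇒≢ j<b (trans (sym (≡ᵇ⇒≡ y j (Equivalence.from T-≡ y≡ᵇj))) y≡b))

≤∸1⇒< : ∀ {m n} → 0 < n → m ≤ n ∸ 1 → m < n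
≤∸1⇒< {n = suc n} _ m≤n = s≤s m≤n

readBit-H : ∀ {m A} q → H m A → readBit q A ≡ false
readBit-H {m} q H-∅               = xorWeight-⊥ (bitJump q) 0 (2 ^ (m ∸ 1))
readBit-H q (H-Δ {X} {Y} X∈H Y∈H) = trans (readBit-Δ q X Y) (cong₂ _xor_ (readBit-H q X∈H) (readBit-H q Y∈H))
readBit-H {m} q (H-gen (suc (suc e)) j (s≤s (s≤s z≤n)) i≤m-1 1≤j j≤) = readBit-pair q (suc e) j 1≤j j<2^[e+1] b≤2^[m-1]
  where
  j<2^[e+1] : j < 2 ^ suc e
  j<2^[e+1] = ≤∸1⇒< (m^n>0 2 (suc e)) j≤
  b≤2^[m-1] : 2 ^ suc e + j ≤ 2 ^ (m ∸ 1)
  b≤2^[m-1] = ≤-trans (+-monoʳ-≤ (2 ^ suc e) (<⇒≤ j<2^[e+1]))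
                      (≤-trans (≤-reflexive (cong (2 ^ suc e +_) (sym (+-identityʳ _)))) (^-monoʳ-≤ 2 i≤m-1))

ι-Δ-θ : ∀ N (X Y : Subset N) → ι N X Δ θ N Y ≡ X ++ Y
ι-Δ-θ N X Y = begin
  zipWith _xor_ (X ++ ⊥) (⊥ ++ Y)               ≡⟨ zipWith-++ _xor_ X ⊥ ⊥ Y ⟩
  zipWith _xor_ X ⊥ ++ zipWith _xor_ ⊥ Y        ≡⟨ cong₂ _++_ (zipWith-identityʳ xor-identityʳ X) (zipWith-identityˡ (λ _ → refl) Y) ⟩
  X ++ Y                                        ∎

ι-Δ-ι : ∀ N (X Y : Subset N) → ι N X Δ ι N Y ≡ ι N (X Δ Y)
ι-Δ-ι N X Y = trans (zipWith-++ _xor_ X ⊥ Y ⊥) (cong (X Δ Y ++_) (zipWith-identityˡ (λ _ → refl) ⊥))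

ι-Δ-ι-Δ-ι-Δ-θ : ∀ N (X Y Z W : Subset N) → ι N X Δ ι N Y Δ ι N Z Δ θ N W ≡ (X Δ Y Δ Z) ++ W
ι-Δ-ι-Δ-ι-Δ-θ N X Y Z W rewrite ι-Δ-ι N X Y | ι-Δ-ι N (X Δ Y) Z = ι-Δ-θ N (X Δ Y Δ Z) W

complementIf : ∀ {n} → Bool → Subset n → Subset n
complementIf true  X = ∁ X
complementIf false X = X

∁-Δ : ∀ {n} (X Y : Subset n) → ∁ X Δ Y ≡ ∁ (X Δ Y)
∁-Δ []      []      = refl
∁-Δ (x ∷ X) (y ∷ Y) = cong₂ _∷_ (sym (not-distribˡ-xor x y)) (∁-Δ X Y)

complementIf-Δ : ∀ {n} f (X Y : Subset n) → complementIf f X Δ Y ≡ complementIf f (X Δ Y)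
complementIf-Δ true  X Y = ∁-Δ X Y
complementIf-Δ false X Y = refl

X≢∁X : ∀ {n} → 0 < n → (X : Subset n) → X ≢ ∁ X
X≢∁X {suc n} _ (x ∷ X) X≡∁X = not-¬ refl (∷-injectiveˡ X≡∁X)

readBit-complementIf-⟨⟩ : ∀ q {N} f i → 2 ^ suc q ∣ N → i ≤ N + N → readBit q (complementIf f (⟨_⟩ {N} i)) ≡ bit q i
readBit-complementIf-⟨⟩ q true  i 2^q+1∣N i≤N+N = trans (readBit-∁ q ⟨ i ⟩ 2^q+1∣N) (readBit-⟨⟩ q i 2^q+1∣N i≤N+N)
readBit-complementIf-⟨⟩ q false i 2^q+1∣N i≤N+N = readBit-⟨⟩ q i 2^q+1∣N i≤N+N

Endpoints : ∀ {n} → (Subset n → Set) → Edge n → Set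
Endpoints P (u , v) = P u × P v

disjoint-by : ∀ {n} {P Q : Subset n → Set} {e f : Edge n} → (∀ {u v} → P u → Q v → u ≢ v) →
              Endpoints P e → Endpoints Q f → VertexDisjoint e f
disjoint-by {e = _ , _} {f = _ , _} separates (Pu , Pv) (Qu′ , Qv′) =
  separates Pu Qu′ , separates Pu Qv′ , separates Pv Qu′ , separates Pv Qv′

HasUpper : ∀ {N} → Subset N → Subset (N + N) → Set
HasUpper {N} U v = ∃ λ (L : Subset N) → v ≡ L ++ U

upper-separates : ∀ {N} {U : Subset N} {u v} → 0 < N → HasUpper U u → HasUpper (∁ U) v → u ≢ v
upper-separates {U = U} N>0 (L , refl) (L′ , refl) u≡v = X≢∁X N>0 U (++-injectiveʳ L L′ u≡v)

record Profile (K c S : ℕ) {N : ℕ} (v : Subset (N + N)) : Set where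
  field
    lower upper : Subset N
    halves      : v ≡ lower ++ upper
    a x carry   : ℕ
    carry≤1     : carry ≤ 1
    sum         : a + x ≡ S + carry
    lower-bits  : ∀ q → q < K → readBit q lower ≡ bit q a xor bit q c
    upper-bits  : ∀ q → q < K → readBit q upper ≡ bit q x xor bit q c

profile-separates : ∀ {K N P u c} {v w : Subset (N + N)} →
                    c ≡ 2 ^ suc P * suc (2 * u) → 2 ^ suc (suc P) ∣ N → suc (suc P) ≤ K →
                    Profile K 0 N v → Profile K c (N + c) w → v ≢ w
profile-separates {K} {N} {P} {u} {c} c≡ 2^[P+2]∣N P+2≤K pv pw v≡w =
  carry-clash P u N (a pv) (x pv) (a pw) (x pw) c (carry pv) (carry pw) c≡ 2^[P+2]∣N
    (λ q q≤ → agree (lower pv) (lower pw) (++-injectiveˡ _ _ halves-agree) (lower-bits pv) (lower-bits pw) q (≤-trans (s≤s q≤) P+2≤K))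
    (λ q q≤ → agree (upper pv) (upper pw) (++-injectiveʳ (lower pv) (lower pw) halves-agree) (upper-bits pv) (upper-bits pw)
                    q (≤-trans (s≤s q≤) P+2≤K))
    (sum pv) (sum pw) (carry≤1 pv) (carry≤1 pw)
  where
  open Profile
  halves-agree : lower pv ++ upper pv ≡ lower pw ++ upper pw
  halves-agree = trans (sym (halves pv)) (trans v≡w (halves pw))
  agree : ∀ (X Y : Subset N) → X ≡ Y → ∀ {m n} → (∀ q → q < K → readBit q X ≡ bit q m xor bit q 0) →
          (∀ q → q < K → readBit q Y ≡ bit q n xor bit q c) → ∀ q → q < K → bit q m ≡ bit q n xor bit q c
  agree X .X refl {m} {n} X-bits Y-bits q q<K = begin
    bit q m                ≡⟨ sym (xor-identityʳ _) ⟩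
    bit q m xor false      ≡⟨ cong (bit q m xor_) (sym (bit-0 q)) ⟩
    bit q m xor bit q 0    ≡⟨ sym (X-bits q q<K) ⟩
    readBit q X            ≡⟨ Y-bits q q<K ⟩
    bit q n xor bit q c    ∎

-- e1 = edge₁ true, e1N = edge₁ false, ej = edgeⱼ true and ejN = edgeⱼ false, definitionally.
edge₁ : Bool → (N r : ℕ) → Edge (N + N)
edge₁ f N r = ( ι N (complementIf f ⟨ N ∸ r + 1 ⟩) Δ θ N (complementIf (not f) ⟨ r ∸ 1 ⟩)
              , ι N (complementIf f ⟨ N ∸ r + 2 ⟩) Δ θ N (complementIf (not f) ⟨ r ∸ 1 ⟩) )

edgeⱼ : Bool → (N j s : ℕ) → (A B : Subset N) → Edge (N + N)
edgeⱼ f N j s A B =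
  ( ι N A Δ ι N ⟨ 2 * j ∸ 2 ⟩ Δ ι N (complementIf f ⟨ N + 2 * j ∸ 1 ∸ s ⟩)
      Δ θ N (complementIf (not f) ⟨ s ∸ 1 ⟩ Δ ⟨ 2 * j ∸ 2 ⟩ Δ B)
  , ι N A Δ ι N ⟨ 2 * j ∸ 2 ⟩ Δ ι N (complementIf f ⟨ N + 2 * j ∸ s ⟩)
      Δ θ N (complementIf (not f) ⟨ s ∸ 1 ⟩ Δ ⟨ 2 * j ∸ 2 ⟩ Δ B) )

edge₁-uppers : ∀ f N r → Endpoints (HasUpper {N} (complementIf (not f) ⟨ r ∸ 1 ⟩)) (edge₁ f N r)
edge₁-uppers f N r = (_ , ι-Δ-θ N _ _) , (_ , ι-Δ-θ N _ _)

edgeⱼ-uppers : ∀ f N j s (A B : Subset N) →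
               Endpoints (HasUpper {N} (complementIf (not f) (⟨ s ∸ 1 ⟩ Δ ⟨ 2 * j ∸ 2 ⟩ Δ B))) (edgeⱼ f N j s A B)
edgeⱼ-uppers f N j s A B = (_ , vertex≡) , (_ , vertex≡)
  where
  upper≡ : complementIf (not f) ⟨ s ∸ 1 ⟩ Δ ⟨ 2 * j ∸ 2 ⟩ Δ B ≡ complementIf (not f) (⟨ s ∸ 1 ⟩ Δ ⟨ 2 * j ∸ 2 ⟩ Δ B)
  upper≡ = trans (cong (_Δ B) (complementIf-Δ (not f) ⟨ s ∸ 1 ⟩ ⟨ 2 * j ∸ 2 ⟩)) (complementIf-Δ (not f) _ B)
  vertex≡ : ∀ {D} → ι N A Δ ι N ⟨ 2 * j ∸ 2 ⟩ Δ ι N D Δ θ N (complementIf (not f) ⟨ s ∸ 1 ⟩ Δ ⟨ 2 * j ∸ 2 ⟩ Δ B)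
                    ≡ (A Δ ⟨ 2 * j ∸ 2 ⟩ Δ D) ++ complementIf (not f) (⟨ s ∸ 1 ⟩ Δ ⟨ 2 * j ∸ 2 ⟩ Δ B)
  vertex≡ = trans (ι-Δ-ι-Δ-ι-Δ-θ N _ _ _ _) (cong (_ ++_) upper≡)

edge₁-sum : ∀ N r δ → 1 ≤ r → r ≤ N → N ∸ r + suc δ + (r ∸ 1) ≡ N + δ
edge₁-sum N (suc r) δ _ r≤N = begin
  N ∸ suc r + suc δ + r     ≡⟨ +-assoc (N ∸ suc r) (suc δ) r ⟩
  N ∸ suc r + suc (δ + r)   ≡⟨ cong (λ n → N ∸ suc r + suc n) (+-comm δ r) ⟩
  N ∸ suc r + (suc r + δ)   ≡⟨ sym (+-assoc (N ∸ suc r) (suc r) δ) ⟩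
  N ∸ suc r + suc r + δ     ≡⟨ cong (_+ δ) (m∸n+n≡m r≤N) ⟩
  N + δ                     ∎

edgeⱼ-sums : ∀ N L s → 2 ≤ L → L ∸ 1 ≤ s → s ≤ N + L ∸ 2 →
             N + L ∸ 1 ∸ s + (s ∸ 1) ≡ N + (L ∸ 2) + 0 × N + L ∸ s + (s ∸ 1) ≡ N + (L ∸ 2) + 1
edgeⱼ-sums N (suc zero)    s (s≤s ()) _ _
edgeⱼ-sums N (suc (suc l)) s _ s≥ s≤ rewrite +-suc N (suc l) | +-suc N l with s | s≥ | s≤
... | suc s | _ | s+1≤ = trans (m∸n+n≡m s≤N+l) (sym (+-identityʳ _)) , trans (m∸n+n≡m (≤-trans s≤N+l (n≤1+n _))) (+-comm 1 _)
  where
  s≤N+l : s ≤ N + l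
  s≤N+l = ≤-trans (n≤1+n s) s+1≤

2^suc∣ : ∀ {K N} q → q < K → 2 ^ K ∣ N → 2 ^ suc q ∣ N
2^suc∣ q q<K 2^K∣N = ∣-trans (2^∣2^ q<K) 2^K∣N

edge₁-profiles : ∀ {K N} f r → 2 ^ K ∣ N → 1 ≤ r → r ≤ N → Endpoints (Profile K 0 N {N}) (edge₁ f N r)
edge₁-profiles {K} {N} f r 2^K∣N 1≤r r≤N = vertex 0 z≤n , vertex 1 ≤-refl
  where
  reads : ∀ q → q < K → ∀ g {i} → i ≤ N + N → readBit q (complementIf g (⟨_⟩ {N} i)) ≡ bit q i xor bit q 0
  reads q q<K g {i} i≤N+N = begin
    readBit q (complementIf g ⟨ i ⟩) ≡⟨ readBit-complementIf-⟨⟩ q g i (2^suc∣ q q<K 2^K∣N) i≤N+N ⟩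
    bit q i                          ≡⟨ sym (xor-identityʳ _) ⟩
    bit q i xor false                ≡⟨ cong (bit q i xor_) (sym (bit-0 q)) ⟩
    bit q i xor bit q 0              ∎
  vertex : ∀ δ → δ ≤ 1 → Profile K 0 N {N} (ι N (complementIf f ⟨ N ∸ r + suc δ ⟩) Δ θ N (complementIf (not f) ⟨ r ∸ 1 ⟩))
  vertex δ δ≤1 = record
    { lower      = complementIf f ⟨ N ∸ r + suc δ ⟩
    ; upper      = complementIf (not f) ⟨ r ∸ 1 ⟩
    ; halves     = ι-Δ-θ N _ _
    ; a          = N ∸ r + suc δ
    ; x          = r ∸ 1
    ; carry      = δ
    ; carry≤1    = δ≤1
    ; sum        = edge₁-sum N r δ 1≤r r≤N
    ; lower-bits = λ q q<K → reads q q<K f (m+n≤o⇒m≤o _ a+x≤N+N)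
    ; upper-bits = λ q q<K → reads q q<K (not f) (m+n≤o⇒n≤o _ a+x≤N+N)
    }
    where
    a+x≤N+N : N ∸ r + suc δ + (r ∸ 1) ≤ N + N
    a+x≤N+N = ≤-trans (≤-reflexive (edge₁-sum N r δ 1≤r r≤N)) (+-monoʳ-≤ N (≤-trans δ≤1 (≤-trans 1≤r r≤N)))

edgeⱼ-profiles : ∀ {K N} f j s (A B : Subset N) → 2 ^ K ∣ N → (∀ q → readBit q A ≡ false) → (∀ q → readBit q B ≡ false) →
                 1 ≤ j → 2 * j ∸ 1 ≤ s → s ≤ N + 2 * j ∸ 2 → 2 * j ∸ 2 < N →
                 Endpoints (Profile K (2 * j ∸ 2) (N + (2 * j ∸ 2)) {N}) (edgeⱼ f N j s A B)
edgeⱼ-profiles {K} {N} f j s A B 2^K∣N A-silent B-silent 1≤j s≥ s≤ c<N =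
  vertex (N + 2 * j ∸ 1 ∸ s) 0 z≤n (proj₁ sums) , vertex (N + 2 * j ∸ s) 1 ≤-refl (proj₂ sums)
  where
  c = 2 * j ∸ 2
  t = s ∸ 1
  sums = edgeⱼ-sums N (2 * j) s (*-monoʳ-≤ 2 1≤j) s≥ s≤
  reads : ∀ q → q < K → ∀ g {i} → i ≤ N + N → readBit q (complementIf g (⟨_⟩ {N} i)) ≡ bit q i
  reads q q<K g {i} = readBit-complementIf-⟨⟩ q g i (2^suc∣ q q<K 2^K∣N)
  c≤N+N : c ≤ N + N
  c≤N+N = ≤-trans (<⇒≤ c<N) (m≤m+n N N)
  vertex : ∀ b δ → δ ≤ 1 → b + t ≡ N + c + δ →
           Profile K c (N + c) {N} (ι N A Δ ι N ⟨ c ⟩ Δ ι N (complementIf f ⟨ b ⟩) Δ θ N (complementIf (not f) ⟨ t ⟩ Δ ⟨ c ⟩ Δ B))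
  vertex b δ δ≤1 b+t≡ = record
    { lower      = A Δ ⟨ c ⟩ Δ complementIf f ⟨ b ⟩
    ; upper      = complementIf (not f) ⟨ t ⟩ Δ ⟨ c ⟩ Δ B
    ; halves     = ι-Δ-ι-Δ-ι-Δ-θ N _ _ _ _
    ; a          = b
    ; x          = t
    ; carry      = δ
    ; carry≤1    = δ≤1
    ; sum        = b+t≡
    ; lower-bits = λ q q<K → begin
        readBit q (A Δ ⟨ c ⟩ Δ complementIf f ⟨ b ⟩)                            ≡⟨ readBit-Δ₃ q A ⟨ c ⟩ (complementIf f ⟨ b ⟩) ⟩
        (readBit q A xor readBit q ⟨ c ⟩) xor readBit q (complementIf f ⟨ b ⟩)  ≡⟨ cong₂ (λ p r → (p xor readBit q ⟨ c ⟩) xor r)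
                                                                                           (A-silent q) (reads q q<K f b≤N+N) ⟩
        readBit q ⟨ c ⟩ xor bit q b                                              ≡⟨ cong (_xor bit q b) (reads q q<K false c≤N+N) ⟩
        bit q c xor bit q b                                                      ≡⟨ xor-comm (bit q c) (bit q b) ⟩
        bit q b xor bit q c                                                      ∎
    ; upper-bits = λ q q<K → begin
        readBit q (complementIf (not f) ⟨ t ⟩ Δ ⟨ c ⟩ Δ B)                            ≡⟨ readBit-Δ₃ q (complementIf (not f) ⟨ t ⟩) ⟨ c ⟩ B ⟩
        (readBit q (complementIf (not f) ⟨ t ⟩) xor readBit q ⟨ c ⟩) xor readBit q B  ≡⟨ cong₂ (λ p r → (p xor readBit q ⟨ c ⟩) xor r)
                                                                                                 (reads q q<K (not f) t≤N+N) (B-silent q) ⟩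
        (bit q t xor readBit q ⟨ c ⟩) xor false                                        ≡⟨ xor-identityʳ _ ⟩
        bit q t xor readBit q ⟨ c ⟩                                                    ≡⟨ cong (bit q t xor_) (reads q q<K false c≤N+N) ⟩
        bit q t xor bit q c                                                            ∎
    }
    where
    c+δ≤N : c + δ ≤ N
    c+δ≤N = ≤-trans (+-monoʳ-≤ c δ≤1) (≤-trans (≤-reflexive (+-comm c 1)) c<N)
    b+t≤N+N : b + t ≤ N + N
    b+t≤N+N = ≤-trans (≤-reflexive (trans b+t≡ (+-assoc N c δ))) (+-monoʳ-≤ N c+δ≤N)
    b≤N+N : b ≤ N + N
    b≤N+N = m+n≤o⇒m≤o b b+t≤N+N
    t≤N+N : t ≤ N + N
    t≤N+N = m+n≤o⇒n≤o b b+t≤N+N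

2*j∸2-odd-part : ∀ k j → 2 ≤ j → j ≤ 2 ^ k →
                 2 * j ∸ 2 < 2 ^ suc k × ∃₂ λ P u → 2 * j ∸ 2 ≡ 2 ^ suc P * suc (2 * u) × suc (suc P) ≤ suc k
2*j∸2-odd-part k (suc zero)    (s≤s ()) _
2*j∸2-odd-part k (suc (suc i)) _ j≤2^k with odd-part (suc i) (s≤s z≤n)
... | P , u , i+1≡ = c<N , P , u , c≡ , 2^-cancel-< (≤-<-trans (m≤m*n (2 ^ suc P) (suc (2 * u))) (subst (_< 2 ^ suc k) c≡ c<N))
  where
  c≡2[i+1] : 2 * suc (suc i) ∸ 2 ≡ 2 * suc i
  c≡2[i+1] = sym (*-distribˡ-∸ 2 (suc (suc i)) 1)
  c≡ : 2 * suc (suc i) ∸ 2 ≡ 2 ^ suc P * suc (2 * u)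
  c≡ = trans c≡2[i+1] (trans (cong (2 *_) i+1≡) (sym (*-assoc 2 (2 ^ P) _)))
  c<N : 2 * suc (suc i) ∸ 2 < 2 ^ suc k
  c<N = subst (_< 2 ^ suc k) (sym c≡2[i+1]) (*-monoʳ-< 2 j≤2^k)

lemma5p2 : (m : ℕ) → 2 ≤ m →
    (A B : Subset (2 ^ (m ∸ 1))) → H m A → H m B →
    (j r s : ℕ) → 2 ≤ j → j ≤ 2 ^ (m ∸ 2) →
    1 ≤ r → r ≤ 2 ^ (m ∸ 1) →
    2 * j ∸ 1 ≤ s → s ≤ 2 ^ (m ∸ 1) + 2 * j ∸ 2 →
    VertexDisjoint (e1 (2 ^ (m ∸ 1)) r) (e1N (2 ^ (m ∸ 1)) r)
    × VertexDisjoint (e1 (2 ^ (m ∸ 1)) r) (ej (2 ^ (m ∸ 1)) j s A B)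
    × VertexDisjoint (e1 (2 ^ (m ∸ 1)) r) (ejN (2 ^ (m ∸ 1)) j s A B)
    × VertexDisjoint (e1N (2 ^ (m ∸ 1)) r) (ej (2 ^ (m ∸ 1)) j s A B)
    × VertexDisjoint (e1N (2 ^ (m ∸ 1)) r) (ejN (2 ^ (m ∸ 1)) j s A B)
    × VertexDisjoint (ej (2 ^ (m ∸ 1)) j s A B) (ejN (2 ^ (m ∸ 1)) j s A B)
lemma5p2 (suc zero)    (s≤s ())
lemma5p2 (suc (suc k)) _ A B A∈H B∈H j r s 2≤j j≤2^k 1≤r r≤N s≥ s≤ with 2*j∸2-odd-part k j 2≤j j≤2^k
... | c<N , P , u , c≡ , P+2≤k+1 =
    disjoint-by (upper-separates {U = ⟨ r ∸ 1 ⟩} N>0) (edge₁-uppers true N r) (edge₁-uppers false N r)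
  , disjoint-by separates (profiles₁ true) (profilesⱼ true)
  , disjoint-by separates (profiles₁ true) (profilesⱼ false)
  , disjoint-by separates (profiles₁ false) (profilesⱼ true)
  , disjoint-by separates (profiles₁ false) (profilesⱼ false)
  , disjoint-by (upper-separates {U = ⟨ s ∸ 1 ⟩ Δ ⟨ 2 * j ∸ 2 ⟩ Δ B} N>0)
                (edgeⱼ-uppers true N j s A B) (edgeⱼ-uppers false N j s A B)
  where
  N = 2 ^ suc k
  N>0 : 0 < N
  N>0 = m^n>0 2 (suc k)
  separates : ∀ {v w} → Profile (suc k) 0 N {N} v → Profile (suc k) (2 * j ∸ 2) (N + (2 * j ∸ 2)) w → v ≢ w
  separates = profile-separates {u = u} c≡ (2^∣2^ P+2≤k+1) P+2≤k+1
  profiles₁ : ∀ f → Endpoints (Profile (suc k) 0 N {N}) (edge₁ f N r)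
  profiles₁ f = edge₁-profiles f r ∣-refl 1≤r r≤N
  profilesⱼ : ∀ f → Endpoints (Profile (suc k) (2 * j ∸ 2) (N + (2 * j ∸ 2)) {N}) (edgeⱼ f N j s A B)
  profilesⱼ f = edgeⱼ-profiles f j s A B ∣-refl (λ q → readBit-H q A∈H) (λ q → readBit-H q B∈H)
                               (≤-trans (s≤s z≤n) 2≤j) s≥ s≤ c<N
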